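{- Consider an instance $(D,B,\gamma)$ of the periodic aircraft routing problem. If the problem is feasible, then there exists a periodic solution.
   Context: An instance of the periodic aircraft routing problem consists of an Eulerian directed graph $D=(V,A)$ (parallel arcs allowed), a subset $B \subseteq V$, and an integer $\gamma \geq 1$. Let $m=|A|$. A solution is a collection of $m$ semi-infinite walks $W_1,\ldots,W_m$ (walks with a first vertex and infinitely many subsequent arcs) such that (1) each walk visits $B$ infinitely many times, with at most $\gamma$ arcs between two visits, and (2) for every $j=1,2,\ldots$, the $j$th arcs of $W_1,\ldots,W_m$ are pairwise distinct and together form $A$. The problem is feasible if a solution exists. A solution is periodic if each walk $W_i$ is a periodic sequence of arcs. -}

module Defs where

open import Data.Nat using (ℕ; zero; suc; _+_; _≤_; _<_)
open import Data.Fin using (Fin; _≟_)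
open import Data.Fin.Subset using (Subset; _∈_)
open import Data.List using (List; length; filter; allFin)
open import Data.Product using (Σ; ∃; _×_)
open import Relation.Binary.PropositionalEquality using (_≡_)
open import Function.Definitions using (Injective; Surjective)

record Digraph : Set where
  field
    n    : ℕ
    m    : ℕ
    tail : Fin m → Fin n
    head : Fin m → Fin n
open Digraph public

outdeg : (D : Digraph) → Fin (n D) → ℕ
outdeg D v = length (filter (λ a → tail D a ≟ v) (allFin (m D)))

indeg : (D : Digraph) → Fin (n D) → ℕ
indeg D v = length (filter (λ a → head D a ≟ v) (allFin (m D)))

data Reach (D : Digraph) : Fin (n D) → Fin (n D) → Set where
  here : ∀ {v} → Reach D v v
  step : ∀ {v w} (a : Fin (m D)) → tail D a ≡ v → Reach D (head D a) w → Reach D v w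

-- Eulerian: every vertex balanced, and the arcs all lie in one strongly
-- connected component (isolated vertices ignored), i.e. an Eulerian circuit exists.
Eulerian : Digraph → Set
Eulerian D = (∀ v → indeg D v ≡ outdeg D v)
           × (∀ a b → Reach D (head D a) (tail D b))

IsWalk : (D : Digraph) → (ℕ → Fin (m D)) → Set
IsWalk D w = ∀ j → head D (w j) ≡ tail D (w (suc j))

vertexAt : (D : Digraph) → (ℕ → Fin (m D)) → ℕ → Fin (n D)
vertexAt D w zero    = tail D (w zero)
vertexAt D w (suc j) = head D (w j)

VisitsB : (D : Digraph) → Subset (n D) → ℕ → (ℕ → Fin (m D)) → Set
VisitsB D B γ w =
    (∀ k → ∃ λ j → k ≤ j × vertexAt D w j ∈ B)
  × (∀ i → vertexAt D w i ∈ B → ∃ λ j → i < j × j ≤ i + γ × vertexAt D w j ∈ B)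

IsSolution : (D : Digraph) → Subset (n D) → ℕ → (Fin (m D) → ℕ → Fin (m D)) → Set
IsSolution D B γ W =
    (∀ i → IsWalk D (W i))
  × (∀ i → VisitsB D B γ (W i))
  × (∀ j → Injective _≡_ _≡_ (λ i → W i j) × Surjective _≡_ _≡_ (λ i → W i j))

Feasible : (D : Digraph) → Subset (n D) → ℕ → Set
Feasible D B γ = Σ (Fin (m D) → ℕ → Fin (m D)) (IsSolution D B γ)

Periodic : {A : Set} → (ℕ → A) → Set
Periodic w = ∃ λ p → 1 ≤ p × (∀ j → w (j + p) ≡ w j)

IsPeriodicSolution : (D : Digraph) → Subset (n D) → ℕ → (Fin (m D) → ℕ → Fin (m D)) → Set
IsPeriodicSolution D B γ W = IsSolution D B γ W × (∀ i → Periodic (W i))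

-- In a solution the tuple of the next γ + 1 arcs of all walks can take only finitely many
-- values, so by pigeonhole it repeats: at some time j, after every walk has visited B once,
-- the window starting at j + p equals the one starting at j.  Replaying the arcs at times
-- j, …, j + p − 1 forever gives a periodic solution: every time step is a permutation of A
-- as before, and every γ + 1 consecutive arcs of the loop already occur consecutively in
-- the original walks, which is all that the walk and B-visit conditions look at.
module Submission where

open import Defs
open import Data.Nat using (ℕ; _≤_)
open import Data.Fin using (Fin)
open import Data.Fin.Subset using (Subset)
open import Data.Product using (Σ)

open import Data.Nat using (zero; suc; _+_; _*_; _∸_; _^_; _<_; z≤n; s≤s; _<?_)
open import Data.Nat.Properties
open import Data.Nat.DivMod using (_%_; _/_; m≡m%n+[m/n]*n; [m+n]%n≡m%n; %-distribˡ-+; m%n%n≡m%n; m%n<n)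
open import Data.Fin using (toℕ; fromℕ<; funToFin; finToFun)
open import Data.Fin.Properties using (pigeonhole; finToFun-funToFin; toℕ-fromℕ<)
open import Data.Fin.Subset using (_∈_)
open import Data.List using (tabulate)
open import Data.List.Extrema.Nat using (max; xs≤max)
open import Data.List.Relation.Unary.All.Properties using (tabulate⁻)
open import Data.Product using (_,_; proj₁; proj₂; ∃; ∃₂; _×_)
open import Relation.Binary.PropositionalEquality
open import Relation.Nullary using (yes; no)
open import Function using (_∘_)
open ≡-Reasoning

Ahead : (ℕ → Set) → ℕ → ℕ → Set
Ahead P γ x = ∃ λ j → x < j × j ≤ x + γ × P j

module _ {P : ℕ → Set} {γ : ℕ} (gaps : ∀ i → P i → Ahead P γ i) where

  ahead-suc : ∀ {x} → Ahead P γ x → Ahead P γ (suc x)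
  ahead-suc {x} (j , x<j , j≤x+γ , pj) with suc x <? j
  ... | yes 1+x<j = j , 1+x<j , ≤-trans j≤x+γ (n≤1+n (x + γ)) , pj
  ... | no  1+x≮j = subst (Ahead P γ) (≤-antisym (≮⇒≥ 1+x≮j) x<j) (gaps j pj)

  ahead-from : ∀ {u} → P u → ∀ d → Ahead P γ (d + u)
  ahead-from pu zero    = gaps _ pu
  ahead-from pu (suc d) = ahead-suc (ahead-from pu d)

  ahead-beyond : ∀ {u x} → P u → u ≤ x → Ahead P γ x
  ahead-beyond {u} {x} pu u≤x = subst (Ahead P γ) (m∸n+n≡m u≤x) (ahead-from pu (x ∸ u))

ahead-shift : ∀ {P Q : ℕ → Set} {γ x t} →
  (∀ e → e ≤ γ → P (x + e) → Q (t + e)) → Ahead P γ x → Ahead Q γ t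
ahead-shift {P} {γ = γ} {x} {t} transfer (j , x<j , j≤x+γ , pj) =
  t + e , m<m+n t (m<n⇒0<n∸m x<j) , +-monoʳ-≤ t e≤γ , transfer e e≤γ (subst P (sym x+e≡j) pj)
  where
  e = j ∸ x
  x+e≡j : x + e ≡ j
  x+e≡j = m+[n∸m]≡n (<⇒≤ x<j)
  e≤γ : e ≤ γ
  e≤γ = +-cancelˡ-≤ x e γ (subst (_≤ x + γ) (sym x+e≡j) j≤x+γ)

bounded-witnesses : ∀ {k} {P : Fin k → ℕ → Set} →
  (∀ i → ∃ (P i)) → ∃ λ K → ∀ i → ∃ λ u → u ≤ K × P i u
bounded-witnesses witness =
  K , λ i → proj₁ (witness i) , tabulate⁻ (xs≤max 0 (tabulate (proj₁ ∘ witness))) i , proj₂ (witness i)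
  where K = max 0 (tabulate (proj₁ ∘ witness))

repeats-after : ∀ {N} (s : ℕ → Fin N) K → ∃₂ λ j q → K ≤ j × s j ≡ s (j + suc q)
repeats-after {N} s K with a , b , a<b , sa≡sb ← pigeonhole (n<1+n N) (λ t → s (K + toℕ t)) =
  K + toℕ a , q , m≤m+n K (toℕ a) , trans sa≡sb (cong s (sym j+1+q≡K+b))
  where
  q = toℕ b ∸ suc (toℕ a)
  j+1+q≡K+b : K + toℕ a + suc q ≡ K + toℕ b
  j+1+q≡K+b = trans (+-assoc K (toℕ a) (suc q))
                    (cong (K +_) (trans (+-suc (toℕ a) q) (m+[n∸m]≡n a<b)))

funToFin-injective : ∀ {a b} {f g : Fin a → Fin b} → funToFin f ≡ funToFin g → ∀ x → f x ≡ g x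
funToFin-injective {f = f} {g} eq x =
  trans (sym (finToFun-funToFin f x)) (trans (cong (λ c → finToFun c x) eq) (finToFun-funToFin g x))

window : ∀ {c d} (W : Fin c → ℕ → Fin d) γ → ℕ → Fin c → Fin (suc γ) → Fin d
window W γ t i k = W i (t + toℕ k)

snapshot : ∀ {c d} (W : Fin c → ℕ → Fin d) γ → ℕ → Fin ((d ^ suc γ) ^ c)
snapshot W γ t = funToFin (λ i → funToFin (window W γ t i))

window-repeats : ∀ {c d} (W : Fin c → ℕ → Fin d) γ K →
  ∃₂ λ j q → K ≤ j × (∀ i k → k ≤ γ → W i (j + suc q + k) ≡ W i (j + k))
window-repeats W γ K with j , q , K≤j , same ← repeats-after (snapshot W γ) K =
  j , q , K≤j , λ i k k≤γ →
    subst (λ e → W i (j + suc q + e) ≡ W i (j + e)) (toℕ-fromℕ< (s≤s k≤γ))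
      (sym (funToFin-injective {f = window W γ j i} {g = window W γ (j + suc q) i}
                               (funToFin-injective same i) (fromℕ< (s≤s k≤γ))))

module Loop {A : Set} (w : ℕ → A) (j q γ : ℕ)
  (repeats : ∀ k → k ≤ γ → w (j + suc q + k) ≡ w (j + k)) where

  loop : ℕ → A
  loop t = w (j + t % suc q)

  loop-periodic : ∀ t → loop (t + suc q) ≡ loop t
  loop-periodic t = cong (λ r → w (j + r)) ([m+n]%n≡m%n t (suc q))

  unroll : ∀ d r → d * suc q + r ≤ q + γ → w (j + (d * suc q + r)) ≡ w (j + r)
  unroll zero    r _     = refl
  unroll (suc d) r bound = begin
    w (j + (suc q + d * suc q + r))   ≡⟨ cong w (trans (cong (j +_) (+-assoc (suc q) _ r))
                                                       (sym (+-assoc j (suc q) _))) ⟩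
    w (j + suc q + (d * suc q + r))   ≡⟨ repeats _ (<⇒≤ x<γ) ⟩
    w (j + (d * suc q + r))           ≡⟨ unroll d r (≤-trans (<⇒≤ x<γ) (m≤n+m γ q)) ⟩
    w (j + r)                         ∎
    where
    x<γ : d * suc q + r < γ
    x<γ = +-cancelˡ-≤ q _ γ (subst (_≤ q + γ)
            (trans (+-assoc (suc q) (d * suc q) r) (sym (+-suc q _))) bound)

  loop-agrees : ∀ y → y ≤ q + γ → w (j + y % suc q) ≡ w (j + y)
  loop-agrees y y≤ = begin
    w (j + y % suc q)                             ≡⟨ unroll (y / suc q) (y % suc q) (subst (_≤ q + γ) y≡ y≤) ⟨
    w (j + (y / suc q * suc q + y % suc q))       ≡⟨ cong (λ z → w (j + z)) y≡ ⟨
    w (j + y)                                     ∎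
    where
    y≡ : y ≡ y / suc q * suc q + y % suc q
    y≡ = trans (m≡m%n+[m/n]*n y (suc q)) (+-comm (y % suc q) _)

  loop-lookahead : ∀ t e → e ≤ γ → loop (t + e) ≡ w (j + t % suc q + e)
  loop-lookahead t e e≤γ = begin
    w (j + (t + e) % suc q)           ≡⟨ cong (λ z → w (j + z)) mod-shift ⟩
    w (j + (t % suc q + e) % suc q)   ≡⟨ loop-agrees _ (+-mono-≤ (m<1+n⇒m≤n (m%n<n t (suc q))) e≤γ) ⟩
    w (j + (t % suc q + e))           ≡⟨ cong w (+-assoc j _ e) ⟨
    w (j + t % suc q + e)             ∎
    where
    mod-shift : (t + e) % suc q ≡ (t % suc q + e) % suc q
    mod-shift = begin
      (t + e) % suc q                               ≡⟨ %-distribˡ-+ t e (suc q) ⟩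
      (t % suc q + e % suc q) % suc q               ≡⟨ cong (λ r → (r + e % suc q) % suc q) (m%n%n≡m%n t (suc q)) ⟨
      (t % suc q % suc q + e % suc q) % suc q       ≡⟨ %-distribˡ-+ (t % suc q) e (suc q) ⟨
      (t % suc q + e) % suc q                       ∎

vertexAt-tail : ∀ {D w} → IsWalk D w → ∀ t → vertexAt D w t ≡ tail D (w t)
vertexAt-tail walk zero    = refl
vertexAt-tail walk (suc t) = walk t

visitsB-from-ahead : ∀ {D B γ w} → (∀ x → Ahead (λ t → vertexAt D w t ∈ B) γ x) → VisitsB D B γ w
visitsB-from-ahead ahead =
  (λ k → let (t , k<t , _ , v) = ahead k in t , <⇒≤ k<t , v) , (λ x _ → ahead x)

loop-solution : ∀ D B γ → 1 ≤ γ → (W : Fin (m D) → ℕ → Fin (m D)) → IsSolution D B γ W →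
  ∀ K → (∀ i → ∃ λ u → u ≤ K × vertexAt D (W i) u ∈ B) →
  ∀ j q → K ≤ j → (∀ i k → k ≤ γ → W i (j + suc q + k) ≡ W i (j + k)) →
  Σ (Fin (m D) → ℕ → Fin (m D)) (IsPeriodicSolution D B γ)
loop-solution D B γ 1≤γ W (walk , visits , perm) K early j q K≤j repeats =
  W′ , (walk′ , visits′ , λ t → perm (j + t % suc q)) , λ i → suc q , s≤s z≤n , L.loop-periodic i
  where
  module L i = Loop (W i) j q γ (repeats i)

  W′ : Fin (m D) → ℕ → Fin (m D)
  W′ = L.loop

  walk′ : ∀ i → IsWalk D (W′ i)
  walk′ i t = trans (walk i x) (cong (tail D) (begin
    W i (suc x)      ≡⟨ cong (W i) (+-comm 1 x) ⟩
    W i (x + 1)      ≡⟨ L.loop-lookahead i t 1 1≤γ ⟨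
    W′ i (t + 1)     ≡⟨ cong (W′ i) (+-comm t 1) ⟩
    W′ i (suc t)     ∎))
    where x = j + t % suc q

  vertexAt-lookahead : ∀ i t e → e ≤ γ →
    vertexAt D (W′ i) (t + e) ≡ vertexAt D (W i) (j + t % suc q + e)
  vertexAt-lookahead i t e e≤γ = begin
    vertexAt D (W′ i) (t + e)            ≡⟨ vertexAt-tail (walk′ i) (t + e) ⟩
    tail D (W′ i (t + e))                ≡⟨ cong (tail D) (L.loop-lookahead i t e e≤γ) ⟩
    tail D (W i (j + t % suc q + e))     ≡⟨ vertexAt-tail {D} (walk i) _ ⟨
    vertexAt D (W i) (j + t % suc q + e) ∎

  ahead′ : ∀ i t → Ahead (λ s → vertexAt D (W′ i) s ∈ B) γ t
  ahead′ i t with u , u≤K , visit ← early i =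
    ahead-shift (λ e e≤γ → subst (_∈ B) (sym (vertexAt-lookahead i t e e≤γ)))
      (ahead-beyond (proj₂ (visits i)) visit (≤-trans u≤K (≤-trans K≤j (m≤m+n j _))))

  visits′ : ∀ i → VisitsB D B γ (W′ i)
  visits′ i = visitsB-from-ahead (ahead′ i)

proposition2p1 : (D : Digraph) → Eulerian D → (B : Subset (n D)) → (γ : ℕ) → 1 ≤ γ →
    Feasible D B γ → Σ (Fin (m D) → ℕ → Fin (m D)) (IsPeriodicSolution D B γ)
proposition2p1 D _ B γ 1≤γ (W , solution@(_ , visits , _))
  with K , early ← bounded-witnesses (λ i → let (u , _ , v) = proj₁ (visits i) 0 in u , v)
  with j , q , K≤j , repeats ← window-repeats W γ K
  = loop-solution D B γ 1≤γ W solution K early j q K≤j repeats
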